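{- For every positive integer $n$, $P(n,2) \le \dfrac{n!}{2^{\lfloor n/2\rfloor}}$.
   Context: A permutation on $\{1,\dots,n\}$ is a sequence listing each element of $\{1,\dots,n\}$ exactly once. The Chebyshev distance between permutations $\sigma,\pi$ is $\max_{i}|\sigma(i)-\pi(i)|$. $P(n,d)$ denotes the maximum cardinality of a set of permutations on $\{1,\dots,n\}$ in which any two distinct permutations have Chebyshev distance at least $d$. -}

module Defs where

open import Data.Nat using (ℕ; _⊔_; ∣_-_∣; _≤_)
open import Data.Fin using (Fin; toℕ)
open import Data.Fin.Permutation using (Permutation′; _⟨$⟩ʳ_)
open import Data.List using (List; foldr; map; allFin)
open import Data.List.Relation.Unary.AllPairs using (AllPairs)

-- Chebyshev distance: max over i of |σ(i) - π(i)| (values as naturals;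
-- the 0-based encoding of Fin n does not change differences).
chebyshev : ∀ {n} → Permutation′ n → Permutation′ n → ℕ
chebyshev {n} σ π =
  foldr _⊔_ 0 (map (λ i → ∣ toℕ (σ ⟨$⟩ʳ i) - toℕ (π ⟨$⟩ʳ i) ∣) (allFin n))

-- For d ≥ 1 this forces the
-- entries to be pairwise distinct, so the length is the cardinality of the set.
IsPermCode : (n d : ℕ) → List (Permutation′ n) → Set
IsPermCode n d C = AllPairs (λ σ π → d ≤ chebyshev σ π) C

{-# OPTIONS --safe #-}
module Submission where

-- A permutation σ of {1,…,m+2} is determined by the positions of its two
-- largest values m+1, m+2 and by the permutation of {1,…,m} it induces on the
-- remaining positions.  Forget which of the two large values comes first:
-- if σ and π agree on this unordered pair of positions and their induced
-- permutations are at distance at most 1, then σ and π are at distance at most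
-- 1, because m+1 and m+2 differ by one.  Hence, in a code of minimum distance
-- 2, the members sharing a pair of positions induce a code on {1,…,m}, so
-- P(m+2,2) ≤ C(m+2,2) · P(m,2), and iterating yields n!/2^⌊n/2⌋.

open import Defs
open import Data.Nat using (ℕ; _≤_; _^_; _/_; _!)
open import Data.Nat.Properties using (m^n≢0)
open import Data.List using (List; length)
open import Data.Fin.Permutation using (Permutation′)

open import Data.Nat using (NonZero; zero; suc; _+_; _*_; _∸_; _<_; _⊔_; ∣_-_∣; z≤n; s≤s; s≤s⁻¹; _≟_)
open import Data.Nat.Properties
  using ( ≤-refl; ≤-trans; ≤-reflexive; ≤-<-trans; <-≤-trans; ≤∧≢⇒<; ≮⇒≥; ≰⇒>; <⇒≱; _<?_; _≤?_
        ; +-mono-≤; +-suc; *-distribʳ-+; *-assoc; 1+n≢n; m≤n⇒m≤1+n; ⊔-lub; m⊔n≤o⇒m≤o; m⊔n≤o⇒n≤o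
        ; ∸-monoˡ-≤; m+n∸n≡m; m+[n∸m]≡n; ∣m+n-m+o∣≡∣n-o∣; ∣m-n∣≤m⊔n; module ≤-Reasoning )
open import Data.Nat.DivMod using (m*n/n≡m; m/n≡1+[m∸n]/n)
open import Data.Nat.ListAction using (sum)
open import Data.Nat.Solver using (module +-*-Solver)
open import Data.Fin using (Fin; zero; suc; toℕ; fromℕ; inject₁; punchIn; punchOut)
  renaming (_≟_ to _≟ᶠ_)
open import Data.Fin.Properties
  using (toℕ<n; toℕ≤pred[n]; toℕ-fromℕ; toℕ-inject₁; toℕ-injective; punchIn-punchOut)
open import Data.Fin.Permutation using (_⟨$⟩ʳ_; _⟨$⟩ˡ_; remove; inverseʳ; inverseˡ; punchIn-permute′)
open import Data.List using ([]; _∷_; map; filter; allFin; applyDownFrom)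
open import Data.List.Properties using (length-map; foldr-preservesᵇ; foldr-forcesᵇ)
open import Data.List.Membership.Propositional.Properties using (∈-allFin)
open import Data.List.Relation.Unary.All as All using (All; []; _∷_)
open import Data.List.Relation.Unary.All.Properties as All using (all-filter)
open import Data.List.Relation.Unary.AllPairs as AllPairs using (AllPairs; []; _∷_)
import Data.List.Relation.Unary.AllPairs.Properties as AllPairs
open import Data.List.Relation.Binary.Sublist.Propositional.Properties using (filter-⊆; length-mono-≤)
import Data.List.Relation.Binary.Sublist.Propositional.Properties as Sublist
open import Data.Empty using (⊥-elim)
open import Data.Product using (_×_; _,_)
open import Function using (_∘_; id)
open import Relation.Nullary using (yes; no; ¬?)
open import Relation.Unary using (Decidable)
open import Relation.Binary.PropositionalEquality
  using (_≡_; _≢_; refl; sym; trans; cong; cong₂; subst; module ≡-Reasoning)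

private
  variable
    A B : Set
    n : ℕ

length-filter+length-filter-¬ : ∀ {P : A → Set} (P? : Decidable P) (xs : List A) →
  length (filter P? xs) + length (filter (¬? ∘ P?) xs) ≡ length xs
length-filter+length-filter-¬ P? [] = refl
length-filter+length-filter-¬ P? (x ∷ xs) with P? x
... | yes _ = cong suc (length-filter+length-filter-¬ P? xs)
... | no _ = trans (+-suc _ _) (cong suc (length-filter+length-filter-¬ P? xs))

length-filter-filter≤ : ∀ {P Q : A → Set} (P? : Decidable P) (Q? : Decidable Q) (xs : List A) →
  length (filter P? (filter Q? xs)) ≤ length (filter P? xs)
length-filter-filter≤ P? Q? xs =
  length-mono-≤ (Sublist.filter⁺ P? P? (λ { refl → id }) (filter-⊆ Q? xs))

All-≡⇒AllPairs-≡ : ∀ {f : A → B} {c : B} {xs : List A} →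
  All (λ x → f x ≡ c) xs → AllPairs (λ x y → f x ≡ f y) xs
All-≡⇒AllPairs-≡ [] = []
All-≡⇒AllPairs-≡ (fx≡c ∷ fxs≡c) =
  All.map (λ fy≡c → trans fx≡c (sym fy≡c)) fxs≡c ∷ All-≡⇒AllPairs-≡ fxs≡c

module _ (key : A → ℕ) where

  fibre : ℕ → List A → List A
  fibre j = filter (λ x → key x ≟ j)

  length-≤-sum-fibres : ∀ K (bound : ℕ → ℕ) (xs : List A) → All (λ x → key x < K) xs →
    (∀ j → length (fibre j xs) ≤ bound j) → length xs ≤ sum (applyDownFrom bound K)
  length-≤-sum-fibres zero bound [] _ _ = z≤n
  length-≤-sum-fibres zero bound (_ ∷ _) (() ∷ _) _
  length-≤-sum-fibres (suc K) bound xs keys<1+K fibre≤ = begin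
    length xs                                ≡⟨ length-filter+length-filter-¬ (λ x → key x ≟ K) xs ⟨
    length (fibre K xs) + length others      ≤⟨ +-mono-≤ (fibre≤ K) (length-≤-sum-fibres K bound others keys<K others-fibre≤) ⟩
    bound K + sum (applyDownFrom bound K)    ∎
    where
    open ≤-Reasoning
    others : List A
    others = filter (¬? ∘ (λ x → key x ≟ K)) xs
    keys<K : All (λ x → key x < K) others
    keys<K = All.zipWith (λ (<1+K , ≢K) → ≤∧≢⇒< (s≤s⁻¹ <1+K) ≢K)
      (All.filter⁺ _ keys<1+K , all-filter _ xs)
    others-fibre≤ : ∀ j → length (fibre j others) ≤ bound j
    others-fibre≤ j = ≤-trans (length-filter-filter≤ _ _ xs) (fibre≤ j)

sum-applyDownFrom-const : ∀ K c → sum (applyDownFrom (λ _ → c) K) ≡ K * c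
sum-applyDownFrom-const zero c = refl
sum-applyDownFrom-const (suc K) c = cong (c +_) (sum-applyDownFrom-const K c)

distanceAt : Permutation′ n → Permutation′ n → Fin n → ℕ
distanceAt σ π i = ∣ toℕ (σ ⟨$⟩ʳ i) - toℕ (π ⟨$⟩ʳ i) ∣

chebyshev-≤ : ∀ {c} (σ π : Permutation′ n) → (∀ i → distanceAt σ π i ≤ c) → chebyshev σ π ≤ c
chebyshev-≤ {n} {c} σ π bound =
  foldr-preservesᵇ {P = _≤ c} {f = _⊔_} ⊔-lub z≤n (All.map⁺ {xs = allFin n} (All.universal bound _))

distanceAt≤chebyshev : ∀ (σ π : Permutation′ n) i → distanceAt σ π i ≤ chebyshev σ π
distanceAt≤chebyshev {n} σ π i =
  All.lookup (All.map⁻ (foldr-forcesᵇ {P = _≤ d} ⊔-bounded 0 distances ≤-refl)) (∈-allFin i)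
  where
  d : ℕ
  d = chebyshev {n} σ π
  distances : List ℕ
  distances = map (distanceAt σ π) (allFin n)
  ⊔-bounded : ∀ x y → x ⊔ y ≤ d → x ≤ d × y ≤ d
  ⊔-bounded x y x⊔y≤d = m⊔n≤o⇒m≤o x y x⊔y≤d , m⊔n≤o⇒n≤o x y x⊔y≤d

chebyshev≤pred : ∀ (σ π : Permutation′ (suc n)) → chebyshev σ π ≤ n
chebyshev≤pred σ π = chebyshev-≤ σ π λ i →
  ≤-trans (∣m-n∣≤m⊔n (toℕ (σ ⟨$⟩ʳ i)) (toℕ (π ⟨$⟩ʳ i))) (⊔-lub (toℕ≤pred[n] (σ ⟨$⟩ʳ i)) (toℕ≤pred[n] (π ⟨$⟩ʳ i)))

∣-∣≤1 : ∀ {m u w} → m ≤ u → u ≤ suc m → m ≤ w → w ≤ suc m → ∣ u - w ∣ ≤ 1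
∣-∣≤1 {m} {u} {w} m≤u u≤1+m m≤w w≤1+m = begin
  ∣ u - w ∣                          ≡⟨ cong₂ ∣_-_∣ (m+[n∸m]≡n m≤u) (m+[n∸m]≡n m≤w) ⟨
  ∣ m + (u ∸ m) - m + (w ∸ m) ∣      ≡⟨ ∣m+n-m+o∣≡∣n-o∣ m (u ∸ m) (w ∸ m) ⟩
  ∣ u ∸ m - w ∸ m ∣                  ≤⟨ ∣m-n∣≤m⊔n (u ∸ m) (w ∸ m) ⟩
  (u ∸ m) ⊔ (w ∸ m)                  ≤⟨ ⊔-lub (excess≤1 u≤1+m) (excess≤1 w≤1+m) ⟩
  1                                  ∎
  where
  open ≤-Reasoning
  excess≤1 : ∀ {v} → v ≤ suc m → v ∸ m ≤ 1
  excess≤1 v≤1+m = ≤-trans (∸-monoˡ-≤ m v≤1+m) (≤-reflexive (m+n∸n≡m 1 m))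

length≤1 : ∀ {C : List (Permutation′ n)} → (∀ (σ π : Permutation′ n) → chebyshev σ π ≤ 1) →
  IsPermCode n 2 C → length C ≤ 1
length≤1 {C = []} _ _ = z≤n
length≤1 {C = _ ∷ []} _ _ = ≤-refl
length≤1 {C = σ ∷ π ∷ _} close ((2≤d ∷ _) ∷ _) = ⊥-elim (<⇒≱ {1} 2≤d (close σ π))

toℕ≤toℕ-punchIn : ∀ (i : Fin (suc n)) (j : Fin n) → toℕ j ≤ toℕ (punchIn i j)
toℕ≤toℕ-punchIn zero j = m≤n⇒m≤1+n ≤-refl
toℕ≤toℕ-punchIn (suc i) zero = z≤n
toℕ≤toℕ-punchIn (suc i) (suc j) = s≤s (toℕ≤toℕ-punchIn i j)

toℕ-punchIn-< : ∀ (i : Fin (suc n)) (j : Fin n) → toℕ j < toℕ i → toℕ (punchIn i j) ≡ toℕ j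
toℕ-punchIn-< (suc i) zero _ = refl
toℕ-punchIn-< (suc i) (suc j) (s≤s j<i) = cong suc (toℕ-punchIn-< i j j<i)

data PositionView {m : ℕ} (hi : Fin (suc (suc m))) (lo : Fin (suc m)) : Fin (suc (suc m)) → Set where
  at-hi : PositionView hi lo hi
  at-lo : PositionView hi lo (punchIn hi lo)
  elsewhere : ∀ j → PositionView hi lo (punchIn hi (punchIn lo j))

positionView : ∀ {m} (hi : Fin (suc (suc m))) (lo : Fin (suc m)) i → PositionView hi lo i
positionView hi lo i with hi ≟ᶠ i
... | yes refl = at-hi
... | no hi≢i with lo ≟ᶠ punchOut hi≢i
...   | yes refl = subst (PositionView hi lo) (punchIn-punchOut hi≢i) at-lo
...   | no lo≢i′ = subst (PositionView hi lo)
          (trans (cong (punchIn hi) (punchIn-punchOut lo≢i′)) (punchIn-punchOut hi≢i))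
          (elsewhere (punchOut lo≢i′))

-- hi is the later of the two positions holding m and m + 1 (0-based values) and
-- lo the earlier one, indexed after deleting hi; lo < hi makes (hi, lo) an
-- unordered pair of positions.
record Split {m : ℕ} (σ : Permutation′ (suc (suc m))) : Set where
  field
    hi : Fin (suc (suc m))
    lo : Fin (suc m)
    lo<hi : toℕ lo < toℕ hi
    rest : Permutation′ m
    m≤σ[hi] : m ≤ toℕ (σ ⟨$⟩ʳ hi)
    m≤σ[lo] : m ≤ toℕ (σ ⟨$⟩ʳ punchIn hi lo)
    σ≗rest : ∀ j → toℕ (σ ⟨$⟩ʳ punchIn hi (punchIn lo j)) ≡ toℕ (rest ⟨$⟩ʳ j)

module _ {m : ℕ} (σ : Permutation′ (suc (suc m))) where

  splitBehind : (x : Fin (suc (suc m))) → m ≤ toℕ x →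
    toℕ (σ ⟨$⟩ˡ punchIn x (fromℕ m)) < toℕ (σ ⟨$⟩ˡ x) → Split σ
  splitBehind x m≤x y-before-x = record
    { hi = hi ; lo = lo ; lo<hi = lo<hi ; rest = rest
    ; m≤σ[hi] = subst (λ v → m ≤ toℕ v) (sym (inverseʳ σ)) m≤x
    ; m≤σ[lo] = subst (λ v → m ≤ toℕ v) (sym σ[lo]) m≤y
    ; σ≗rest = σ≗rest }
    where
    hi : Fin (suc (suc m))
    hi = σ ⟨$⟩ˡ x
    σ′ : Permutation′ (suc m)
    σ′ = remove hi σ
    lo : Fin (suc m)
    lo = σ′ ⟨$⟩ˡ fromℕ m
    rest : Permutation′ m
    rest = remove lo σ′

    σ[lo] : σ ⟨$⟩ʳ punchIn hi lo ≡ punchIn x (fromℕ m)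
    σ[lo] = trans (punchIn-permute′ σ x lo) (cong (punchIn x) (inverseʳ σ′))

    m≤y : m ≤ toℕ (punchIn x (fromℕ m))
    m≤y = subst (_≤ toℕ (punchIn x (fromℕ m))) (toℕ-fromℕ m) (toℕ≤toℕ-punchIn x (fromℕ m))

    lo<hi : toℕ lo < toℕ hi
    lo<hi = ≤-<-trans (toℕ≤toℕ-punchIn hi lo)
      (subst (λ p → toℕ p < toℕ hi) (trans (cong (σ ⟨$⟩ˡ_) (sym σ[lo])) (inverseˡ σ)) y-before-x)

    σ≗rest : ∀ j → toℕ (σ ⟨$⟩ʳ punchIn hi (punchIn lo j)) ≡ toℕ (rest ⟨$⟩ʳ j)
    σ≗rest j = begin
      toℕ (σ ⟨$⟩ʳ punchIn hi (punchIn lo j))       ≡⟨ cong toℕ (punchIn-permute′ σ x (punchIn lo j)) ⟩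
      toℕ (punchIn x (σ′ ⟨$⟩ʳ punchIn lo j))       ≡⟨ cong (toℕ ∘ punchIn x) (punchIn-permute′ σ′ (fromℕ m) j) ⟩
      toℕ (punchIn x (punchIn (fromℕ m) r))        ≡⟨ toℕ-punchIn-< x _ (subst (_< toℕ x) (sym r↑≡r) (<-≤-trans (toℕ<n r) m≤x)) ⟩
      toℕ (punchIn (fromℕ m) r)                    ≡⟨ r↑≡r ⟩
      toℕ r                                        ∎
      where
      open ≡-Reasoning
      r : Fin m
      r = rest ⟨$⟩ʳ j
      r↑≡r : toℕ (punchIn (fromℕ m) r) ≡ toℕ r
      r↑≡r = toℕ-punchIn-< (fromℕ m) r (subst (toℕ r <_) (sym (toℕ-fromℕ m)) (toℕ<n r))

  private
    largest secondLargest : Fin (suc (suc m))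
    largest = fromℕ (suc m)
    secondLargest = inject₁ (fromℕ m)

    toℕ-secondLargest : toℕ secondLargest ≡ m
    toℕ-secondLargest = trans (toℕ-inject₁ (fromℕ m)) (toℕ-fromℕ m)

    punchIn-largest : ∀ {k} → punchIn (fromℕ (suc k)) (fromℕ k) ≡ inject₁ (fromℕ k)
    punchIn-largest {zero} = refl
    punchIn-largest {suc k} = cong suc punchIn-largest

    punchIn-secondLargest : ∀ {k} → punchIn (inject₁ (fromℕ k)) (fromℕ k) ≡ fromℕ (suc k)
    punchIn-secondLargest {zero} = refl
    punchIn-secondLargest {suc k} = cong suc punchIn-secondLargest

    positions-differ : toℕ (σ ⟨$⟩ˡ largest) ≢ toℕ (σ ⟨$⟩ˡ secondLargest)
    positions-differ same = 1+n≢n (begin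
      suc m                                       ≡⟨ toℕ-fromℕ (suc m) ⟨
      toℕ largest                                 ≡⟨ cong toℕ (inverseʳ σ) ⟨
      toℕ (σ ⟨$⟩ʳ (σ ⟨$⟩ˡ largest))               ≡⟨ cong (λ p → toℕ (σ ⟨$⟩ʳ p)) (toℕ-injective same) ⟩
      toℕ (σ ⟨$⟩ʳ (σ ⟨$⟩ˡ secondLargest))         ≡⟨ cong toℕ (inverseʳ σ) ⟩
      toℕ secondLargest                           ≡⟨ toℕ-secondLargest ⟩
      m                                           ∎)
      where open ≡-Reasoning

  split : Split σ
  split with toℕ (σ ⟨$⟩ˡ secondLargest) <? toℕ (σ ⟨$⟩ˡ largest)
  ... | yes second-first = splitBehind largest (subst (m ≤_) (sym (toℕ-fromℕ (suc m))) (m≤n⇒m≤1+n ≤-refl))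
          (subst (λ y → toℕ (σ ⟨$⟩ˡ y) < toℕ (σ ⟨$⟩ˡ largest)) (sym punchIn-largest) second-first)
  ... | no ¬second-first = splitBehind secondLargest (≤-reflexive (sym toℕ-secondLargest))
          (subst (λ y → toℕ (σ ⟨$⟩ˡ y) < toℕ (σ ⟨$⟩ˡ secondLargest)) (sym punchIn-secondLargest)
            (≤∧≢⇒< (≮⇒≥ ¬second-first) positions-differ))

chebyshev≤1-of-rest : ∀ {m} {σ π : Permutation′ (suc (suc m))} (s : Split σ) (t : Split π) →
  Split.hi s ≡ Split.hi t → Split.lo s ≡ Split.lo t →
  chebyshev (Split.rest s) (Split.rest t) ≤ 1 → chebyshev σ π ≤ 1
chebyshev≤1-of-rest {m} {σ} {π} s t refl refl rests-close = chebyshev-≤ σ π close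
  where
  open Split
  close : ∀ i → distanceAt σ π i ≤ 1
  close i with positionView (hi s) (lo s) i
  ... | at-hi = ∣-∣≤1 (m≤σ[hi] s) (toℕ≤pred[n] _) (m≤σ[hi] t) (toℕ≤pred[n] _)
  ... | at-lo = ∣-∣≤1 (m≤σ[lo] s) (toℕ≤pred[n] _) (m≤σ[lo] t) (toℕ≤pred[n] _)
  ... | elsewhere j = subst (_≤ 1) (sym (cong₂ ∣_-_∣ (σ≗rest s j) (σ≗rest t j)))
          (≤-trans (distanceAt≤chebyshev (rest s) (rest t) j) rests-close)

module _ {m : ℕ} where

  hiKey loKey : Permutation′ (suc (suc m)) → ℕ
  hiKey σ = toℕ (Split.hi (split σ))
  loKey σ = toℕ (Split.lo (split σ))

  reduce : Permutation′ (suc (suc m)) → Permutation′ m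
  reduce σ = Split.rest (split σ)

  reduce-separated : ∀ {σ π} → 2 ≤ chebyshev σ π → hiKey σ ≡ hiKey π × loKey σ ≡ loKey π →
    2 ≤ chebyshev (reduce σ) (reduce π)
  reduce-separated {σ} {π} 2≤d (hi≡ , lo≡) with chebyshev (reduce σ) (reduce π) ≤? 1
  ... | yes close = ⊥-elim (<⇒≱ {1} 2≤d
          (chebyshev≤1-of-rest (split σ) (split π) (toℕ-injective hi≡) (toℕ-injective lo≡) close))
  ... | no far = ≰⇒> far

  reduce-fibres-isPermCode : ∀ j k {C : List (Permutation′ (suc (suc m)))} → IsPermCode _ 2 C →
    IsPermCode m 2 (map reduce (fibre loKey k (fibre hiKey j C)))
  reduce-fibres-isPermCode j k {C} code = AllPairs.map⁺ (AllPairs.zipWith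
    (λ {σ} {π} (2≤d , same-keys) → reduce-separated {σ} {π} 2≤d same-keys)
    (AllPairs.filter⁺ _ (AllPairs.filter⁺ _ code) , AllPairs.zip (same-hi , same-lo)))
    where
    same-hi : AllPairs (λ σ π → hiKey σ ≡ hiKey π) (fibre loKey k (fibre hiKey j C))
    same-hi = All-≡⇒AllPairs-≡ (All.filter⁺ _ (all-filter _ C))
    same-lo : AllPairs (λ σ π → loKey σ ≡ loKey π) (fibre loKey k (fibre hiKey j C))
    same-lo = All-≡⇒AllPairs-≡ (all-filter _ (fibre hiKey j C))

codeBound : ℕ → ℕ
codeBound zero = 1
codeBound (suc zero) = 1
codeBound (suc (suc m)) = sum (applyDownFrom (_* codeBound m) (suc (suc m)))

length≤codeBound : ∀ n (C : List (Permutation′ n)) → IsPermCode n 2 C → length C ≤ codeBound n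
length≤codeBound zero C code = length≤1 (λ _ _ → z≤n) code
length≤codeBound (suc zero) C code = length≤1 (λ σ π → m≤n⇒m≤1+n (chebyshev≤pred σ π)) code
length≤codeBound (suc (suc m)) C code =
  length-≤-sum-fibres hiKey (suc (suc m)) _ C (All.universal (λ _ → toℕ<n _) C) hi-fibre≤
  where
  hi-fibre≤ : ∀ j → length (fibre hiKey j C) ≤ j * codeBound m
  hi-fibre≤ j = subst (length (fibre hiKey j C) ≤_) (sum-applyDownFrom-const j (codeBound m))
    (length-≤-sum-fibres loKey j _ (fibre hiKey j C) lo<j λ k →
      subst (_≤ codeBound m) (length-map reduce (fibre loKey k (fibre hiKey j C)))
        (length≤codeBound m _ (reduce-fibres-isPermCode j k code)))
    where
    lo<j : All (λ σ → loKey σ < j) (fibre hiKey j C)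
    lo<j = All.map (λ {σ} hi≡j → subst (loKey σ <_) hi≡j (Split.lo<hi (split σ))) (all-filter _ C)

sum-applyDownFrom-*-*2 : ∀ K c → sum (applyDownFrom (_* c) (suc K)) * 2 ≡ suc K * K * c
sum-applyDownFrom-*-*2 zero c = refl
sum-applyDownFrom-*-*2 (suc K) c = begin
  (suc K * c + S) * 2                ≡⟨ *-distribʳ-+ 2 (suc K * c) S ⟩
  suc K * c * 2 + S * 2              ≡⟨ cong (suc K * c * 2 +_) (sum-applyDownFrom-*-*2 K c) ⟩
  suc K * c * 2 + suc K * K * c      ≡⟨ solve 2 (λ K c → (con 1 :+ K) :* c :* con 2 :+ (con 1 :+ K) :* K :* c
                                                    := (con 2 :+ K) :* (con 1 :+ K) :* c) refl K c ⟩
  suc (suc K) * suc K * c            ∎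
  where
  open ≡-Reasoning
  open +-*-Solver
  S : ℕ
  S = sum (applyDownFrom (_* c) (suc K))

codeBound*2^⌊n/2⌋≡n! : ∀ n → codeBound n * 2 ^ (n / 2) ≡ n !
codeBound*2^⌊n/2⌋≡n! zero = refl
codeBound*2^⌊n/2⌋≡n! (suc zero) = refl
codeBound*2^⌊n/2⌋≡n! (suc (suc n)) = begin
  codeBound (2 + n) * 2 ^ ((2 + n) / 2)         ≡⟨ cong (λ e → codeBound (2 + n) * 2 ^ e) (m/n≡1+[m∸n]/n {2 + n} {2} (s≤s (s≤s z≤n))) ⟩
  codeBound (2 + n) * (2 * 2 ^ (n / 2))         ≡⟨ *-assoc (codeBound (2 + n)) 2 _ ⟨
  codeBound (2 + n) * 2 * 2 ^ (n / 2)           ≡⟨ cong (_* 2 ^ (n / 2)) (sum-applyDownFrom-*-*2 (suc n) (codeBound n)) ⟩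
  (2 + n) * (1 + n) * codeBound n * 2 ^ (n / 2) ≡⟨ solve 4 (λ a b c d → a :* b :* c :* d := a :* (b :* (c :* d))) refl (2 + n) (1 + n) (codeBound n) _ ⟩
  (2 + n) * ((1 + n) * (codeBound n * 2 ^ (n / 2))) ≡⟨ cong (λ e → (2 + n) * ((1 + n) * e)) (codeBound*2^⌊n/2⌋≡n! n) ⟩
  (2 + n) !                                     ∎
  where
  open ≡-Reasoning
  open +-*-Solver

corollary4 : (n : ℕ) → 1 ≤ n → (C : List (Permutation′ n)) → IsPermCode n 2 C →
    length C ≤ _/_ (n !) (2 ^ (n / 2)) {{m^n≢0 2 (n / 2)}}
corollary4 n _ C code = begin
  length C                                  ≤⟨ length≤codeBound n C code ⟩
  codeBound n                               ≡⟨ m*n/n≡m (codeBound n) (2 ^ (n / 2)) ⟨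
  codeBound n * 2 ^ (n / 2) / 2 ^ (n / 2)   ≡⟨ cong (_/ 2 ^ (n / 2)) (codeBound*2^⌊n/2⌋≡n! n) ⟩
  n ! / 2 ^ (n / 2)                         ∎
  where
  open ≤-Reasoning
  instance
    2^⌊n/2⌋≢0 : NonZero (2 ^ (n / 2))
    2^⌊n/2⌋≢0 = m^n≢0 2 (n / 2)
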